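{- Let $\mathscr{C}$ be a finitary many-sorted variety and $F\colon\mathscr{C}\to\mathscr{C}$ an endofunctor preserving sifted colimits. Let $D_Y$ be a filtered diagram of ffg objects $Y_i$ ($i\in I$), with colimit cocone $y_i\colon Y_i\to Y$ and connecting morphisms $y_{ij}$. Let $(A,[a,h_i],(-)^{\dagger,i})$ ($i\in I$) be a compatible family of ffg-Elgot algebras. For an ffg-equation $e\colon X\to FX+A$ for $F$, set $e^\dagger=\big((FX+\iota_i)\cdot e\big)^{\dagger,i}$, where $\iota_i\colon A\to Y_i+A$ is the coproduct injection. Then: (i) $e^\dagger$ does not depend on the choice of $i$; (ii) $(A,a,\dagger)$ is an ffg-Elgot algebra for $F$; (iii) the morphisms $h_i$ ($i\in I$) form a cocone of $D_Y$.
   Context: Let $S$ be a set of sorts, $T$ a finitary monad on $\mathbf{Set}^S$, and $\mathscr{C}$ the category of Eilenberg–Moore algebras for $T$, with coproducts $+$ and injections $\mathrm{inl},\mathrm{inr}$. An object is ffg if it is isomorphic to $TX_0$ for a finite $S$-sorted set $X_0$. The definitions below are stated for an endofunctor $G$ of $\mathscr{C}$ preserving sifted colimits, applied to $G=F$ and $G=F(-)+Y_i$. For $G=F(-)+Y_i$, algebra structures have the form $[a,h_i]\colon FA+Y_i\to A$ and ffg-equations have the form $X\to FX+Y_i+A$. Equations and solutions. Put $\mathrm{can}=[G\mathrm{inl},G\mathrm{inr}]$. An ffg-equation is a morphism $e\colon X\to GX+A$ with $X$ ffg. For $k\colon A\to B$ put $k\bullet e=(GX+k)\cdot e$. For $e\colon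 X\to GX+Y'$ and $f\colon Y'\to GY'+Z$ put $e\boxdot f=(\mathrm{can}+Z)\cdot(GX+f)\cdot[e,\mathrm{inr}]$. A solution of $e$ in a $G$-algebra $(A,\alpha)$ is a morphism $s\colon X\to A$ with $s=[\alpha,\mathrm{id}_A]\cdot(Gs+A)\cdot e$. ffg-Elgot algebras. An ffg-Elgot algebra for $G$ is a triple $(A,\alpha,\dagger)$ with $\dagger$ assigning solutions to all ffg-equations, subject to two axioms. (Weak Functoriality) For ffg $X,X',Z$, morphisms $e\colon X\to GX+Z$, $f\colon X'\to GX'+Z$ and $m\colon X\to X'$ with $f\cdot m=(Gm+Z)\cdot e$, and $k\colon Z\to A$, one has $(k\bullet f)^\dagger\cdot m=(k\bullet e)^\dagger$. (Compositionality) For ffg $X,Y'$, $e\colon X\to GX+Y'$ and $f\colon Y'\to GY'+A$, one has $(f^\dagger\bullet e)^\dagger=(e\boxdot f)^\dagger\cdot\mathrm{inl}$. Compatible families. A compatible family of ffg-Elgot algebras is a family $(A,[a,h_i],(-)^{\dagger,i})$ ($i\in I$) of ffg-Elgot algebras for $F(-)+Y_i$, with the same $A$ and $a$ and with $h_i\colon Y_i\to A$, such that for every connecting morphism $y_{ij}\colon Y_i\to Y_j$ and every ffg-equation $e\colon X\to FX+Y_i+A$ one has $((FX+y_{ij}+A)\cdot e)^{\dagger,j}=e^{\dagger,i}$. -}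

module Defs where

open import Level using (Level; _⊔_; 0ℓ) renaming (suc to lsuc)
open import Data.Nat using (ℕ)
open import Data.Fin using (Fin)
open import Data.Product using (Σ; Σ-syntax; _×_; _,_; proj₁; proj₂)
open import Relation.Binary.Structures using (IsEquivalence)
open import Relation.Binary.PropositionalEquality using (_≡_)

record Category (o ℓ e : Level) : Set (lsuc (o ⊔ ℓ ⊔ e)) where
  infixr 9 _∘_
  infix 4 _≈_ _⇒_
  field
    Obj : Set o
    _⇒_ : Obj → Obj → Set ℓ
    _≈_ : ∀ {A B} → A ⇒ B → A ⇒ B → Set e
    id  : ∀ {A} → A ⇒ A
    _∘_ : ∀ {A B C} → B ⇒ C → A ⇒ B → A ⇒ C
    equiv     : ∀ {A B} → IsEquivalence (_≈_ {A} {B})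
    assoc     : ∀ {A B C D} {f : A ⇒ B} {g : B ⇒ C} {h : C ⇒ D} →
                (h ∘ g) ∘ f ≈ h ∘ (g ∘ f)
    identityˡ : ∀ {A B} {f : A ⇒ B} → id ∘ f ≈ f
    identityʳ : ∀ {A B} {f : A ⇒ B} → f ∘ id ≈ f
    ∘-resp-≈  : ∀ {A B C} {f h : B ⇒ C} {g i : A ⇒ B} →
                f ≈ h → g ≈ i → f ∘ g ≈ h ∘ i

  module Eq {A B : Obj} = IsEquivalence (equiv {A} {B})

  record Iso (X Y : Obj) : Set (ℓ ⊔ e) where
    field
      to   : X ⇒ Y
      from : Y ⇒ X
      isoˡ : from ∘ to ≈ id
      isoʳ : to ∘ from ≈ id

record Functor {o ℓ e o′ ℓ′ e′ : Level}
               (C : Category o ℓ e) (D : Category o′ ℓ′ e′)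
               : Set (o ⊔ ℓ ⊔ e ⊔ o′ ⊔ ℓ′ ⊔ e′) where
  private
    module C = Category C
    module D = Category D
  field
    F₀ : C.Obj → D.Obj
    F₁ : ∀ {A B} → A C.⇒ B → F₀ A D.⇒ F₀ B
    identity     : ∀ {A} → F₁ (C.id {A}) D.≈ D.id
    homomorphism : ∀ {X Y Z} {f : X C.⇒ Y} {g : Y C.⇒ Z} →
                   F₁ (g C.∘ f) D.≈ F₁ g D.∘ F₁ f
    F-resp-≈     : ∀ {A B} {f g : A C.⇒ B} → f C.≈ g → F₁ f D.≈ F₁ g

SetS : (S : Set) → Category (lsuc 0ℓ) 0ℓ 0ℓ
SetS S = record
  { Obj = S → Set
  ; _⇒_ = λ X Y → ∀ s → X s → Y s
  ; _≈_ = λ f g → ∀ s x → f s x ≡ g s x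
  ; id  = λ s x → x
  ; _∘_ = λ g f s x → g s (f s x)
  ; equiv = record
      { refl  = λ s x → Relation.Binary.PropositionalEquality.refl
      ; sym   = λ p s x → Relation.Binary.PropositionalEquality.sym (p s x)
      ; trans = λ p q s x → Relation.Binary.PropositionalEquality.trans (p s x) (q s x) }
  ; assoc     = λ s x → Relation.Binary.PropositionalEquality.refl
  ; identityˡ = λ s x → Relation.Binary.PropositionalEquality.refl
  ; identityʳ = λ s x → Relation.Binary.PropositionalEquality.refl
  ; ∘-resp-≈  = λ {_} {_} {_} {f} {h} {g} {i} p q s x →
      Relation.Binary.PropositionalEquality.trans
        (Relation.Binary.PropositionalEquality.cong (f s) (q s x)) (p s (i s x))
  }

-- the finite S-sorted set with elements Fin n, element k of sort σ k
-- (every finite S-sorted set is isomorphic to one of this form)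
FinSorted : {S : Set} {n : ℕ} → (Fin n → S) → S → Set
FinSorted {n = n} σ s = Σ (Fin n) (λ k → σ k ≡ s)

record Monad {o ℓ e : Level} (C : Category o ℓ e) : Set (o ⊔ ℓ ⊔ e) where
  open Category C
  field
    T : Functor C C
  open Functor T public
  field
    η : ∀ X → X ⇒ F₀ X
    μ : ∀ X → F₀ (F₀ X) ⇒ F₀ X
    η-natural : ∀ {X Y} (f : X ⇒ Y) → η Y ∘ f ≈ F₁ f ∘ η X
    μ-natural : ∀ {X Y} (f : X ⇒ Y) → μ Y ∘ F₁ (F₁ f) ≈ F₁ f ∘ μ X
    identityˡ-μ : ∀ {X} → μ X ∘ F₁ (η X) ≈ id
    identityʳ-μ : ∀ {X} → μ X ∘ η (F₀ X) ≈ id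
    assoc-μ     : ∀ {X} → μ X ∘ F₁ (μ X) ≈ μ X ∘ μ (F₀ X)

module _ {o ℓ e : Level} {C : Category o ℓ e} (M : Monad C) where
  open Category C
  private module M = Monad M

  record EMAlgebra : Set (o ⊔ ℓ ⊔ e) where
    field
      carrier : Obj
      action  : M.F₀ carrier ⇒ carrier
      unit-law : action ∘ M.η carrier ≈ id
      mult-law : action ∘ M.F₁ action ≈ action ∘ M.μ carrier

  record EMMorphism (A B : EMAlgebra) : Set (ℓ ⊔ e) where
    private
      module A = EMAlgebra A
      module B = EMAlgebra B
    field
      hom     : A.carrier ⇒ B.carrier
      commute : hom ∘ A.action ≈ B.action ∘ M.F₁ hom

  private
    infixr 4 _⟨≈⟩_
    _⟨≈⟩_ : ∀ {A B} {f g h : A ⇒ B} → f ≈ g → g ≈ h → f ≈ h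
    p ⟨≈⟩ q = Eq.trans p q

    idEM : ∀ {A} → EMMorphism A A
    idEM {A} = record
      { hom = id
      ; commute = identityˡ ⟨≈⟩ Eq.sym identityʳ
                  ⟨≈⟩ ∘-resp-≈ Eq.refl (Eq.sym M.identity) }
      where open EMAlgebra A

    compEM : ∀ {A B D} → EMMorphism B D → EMMorphism A B → EMMorphism A D
    compEM {A} {B} {D} g f = record
      { hom = G.hom ∘ F.hom
      ; commute =
          assoc
          ⟨≈⟩ ∘-resp-≈ Eq.refl F.commute
          ⟨≈⟩ Eq.sym assoc
          ⟨≈⟩ ∘-resp-≈ G.commute Eq.refl
          ⟨≈⟩ assoc
          ⟨≈⟩ ∘-resp-≈ Eq.refl (Eq.sym M.homomorphism) }
      where
        module G = EMMorphism g
        module F = EMMorphism f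

  EM : Category (o ⊔ ℓ ⊔ e) (ℓ ⊔ e) e
  EM = record
    { Obj = EMAlgebra
    ; _⇒_ = EMMorphism
    ; _≈_ = λ f g → EMMorphism.hom f ≈ EMMorphism.hom g
    ; id  = idEM
    ; _∘_ = compEM
    ; equiv = record { refl = Eq.refl ; sym = Eq.sym ; trans = Eq.trans }
    ; assoc = assoc
    ; identityˡ = identityˡ
    ; identityʳ = identityʳ
    ; ∘-resp-≈ = ∘-resp-≈
    }

  Free : Obj → EMAlgebra
  Free X = record
    { carrier = M.F₀ X
    ; action  = M.μ X
    ; unit-law = M.identityʳ-μ
    ; mult-law = M.assoc-μ }

IsFfg : {S : Set} (M : Monad (SetS S)) → Category.Obj (EM M) → Set
IsFfg {S} M A = Σ ℕ λ n → Σ (Fin n → S) λ σ →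
  Category.Iso (EM M) (Free M (FinSorted σ)) A

module _ {o ℓ e : Level} (C : Category o ℓ e) where
  open Category C

  module _ {J : Category 0ℓ 0ℓ 0ℓ} (D : Functor J C) where
    private
      module J = Category J
      module D = Functor D

    record Cocone : Set (o ⊔ ℓ ⊔ e) where
      field
        apex : Obj
        leg  : ∀ j → D.F₀ j ⇒ apex
        commute : ∀ {i j} (u : i J.⇒ j) → leg j ∘ D.F₁ u ≈ leg i

    IsColimit : Cocone → Set (o ⊔ ℓ ⊔ e)
    IsColimit K = ∀ (K′ : Cocone) →
      Σ (K.apex ⇒ Cocone.apex K′) λ u →
        (∀ j → u ∘ K.leg j ≈ Cocone.leg K′ j) ×
        (∀ (u′ : K.apex ⇒ Cocone.apex K′) →
           (∀ j → u′ ∘ K.leg j ≈ Cocone.leg K′ j) → u′ ≈ u)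
      where module K = Cocone K

  record BinaryCoproducts : Set (o ⊔ ℓ ⊔ e) where
    infixr 6 _+_
    field
      _+_  : Obj → Obj → Obj
      inl  : ∀ {A B} → A ⇒ A + B
      inr  : ∀ {A B} → B ⇒ A + B
      [_,_] : ∀ {A B Z} → A ⇒ Z → B ⇒ Z → A + B ⇒ Z
      inject₁ : ∀ {A B Z} {f : A ⇒ Z} {g : B ⇒ Z} → [ f , g ] ∘ inl ≈ f
      inject₂ : ∀ {A B Z} {f : A ⇒ Z} {g : B ⇒ Z} → [ f , g ] ∘ inr ≈ g
      unique  : ∀ {A B Z} {f : A ⇒ Z} {g : B ⇒ Z} {h : A + B ⇒ Z} →
                h ∘ inl ≈ f → h ∘ inr ≈ g → h ≈ [ f , g ]

    infixr 6 _+₁_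
    _+₁_ : ∀ {A B A′ B′} → A ⇒ A′ → B ⇒ B′ → A + B ⇒ A′ + B′
    f +₁ g = [ inl ∘ f , inr ∘ g ]

    assocʳ : ∀ {A B Z} → A + (B + Z) ⇒ (A + B) + Z
    assocʳ = [ inl ∘ inl , [ inl ∘ inr , inr ] ]

module _ (J : Category 0ℓ 0ℓ 0ℓ) where
  open Category J

  record IsFiltered : Set where
    field
      nonempty : Obj
      cospan   : ∀ i j → Σ Obj λ k → (i ⇒ k) × (j ⇒ k)
      equalize : ∀ {i j} (u v : i ⇒ j) →
                 Σ Obj λ k → Σ (j ⇒ k) λ w → w ∘ u ≈ w ∘ v

  -- objects of the comma category (i , j) ↓ Δ
  Cospan : Obj → Obj → Set
  Cospan i j = Σ Obj λ k → (i ⇒ k) × (j ⇒ k)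

  CospanArrow : ∀ {i j} → Cospan i j → Cospan i j → Set
  CospanArrow (k , u , v) (k′ , u′ , v′) =
    Σ (k ⇒ k′) λ w → (w ∘ u ≈ u′) × (w ∘ v ≈ v′)

  data Zigzag {i j} : Cospan i j → Cospan i j → Set where
    here : ∀ {c} → Zigzag c c
    fwd  : ∀ {a b c} → CospanArrow a b → Zigzag b c → Zigzag a c
    bwd  : ∀ {a b c} → CospanArrow b a → Zigzag b c → Zigzag a c

  -- J is sifted: nonempty, and the diagonal J → J × J is final,
  -- i.e. every comma category (i , j) ↓ Δ is nonempty and connected
  record IsSifted : Set where
    field
      nonempty  : Obj
      inhabited : ∀ i j → Cospan i j
      connected : ∀ {i j} (a b : Cospan i j) → Zigzag a b

PreservesColimits : {o ℓ e o′ ℓ′ e′ : Level}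
  {C : Category o ℓ e} {D : Category o′ ℓ′ e′} →
  (P : Category 0ℓ 0ℓ 0ℓ → Set) → Functor C D → Set (lsuc 0ℓ ⊔ o ⊔ ℓ ⊔ e ⊔ o′ ⊔ ℓ′ ⊔ e′)
PreservesColimits {C = C} {D = D} P F =
  ∀ (J : Category 0ℓ 0ℓ 0ℓ) → P J → (G : Functor J C) (K : Cocone C G) →
    IsColimit C G K → IsColimit D (F ∘F G) (mapCocone K)
  where
    module F = Functor F
    module D = Category D
    _∘F_ : {J : Category 0ℓ 0ℓ 0ℓ} → Functor C D → Functor J C → Functor J D
    H ∘F G = record
      { F₀ = λ j → H.F₀ (G.F₀ j)
      ; F₁ = λ u → H.F₁ (G.F₁ u)
      ; identity = D.Eq.trans (H.F-resp-≈ G.identity) H.identity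
      ; homomorphism = D.Eq.trans (H.F-resp-≈ G.homomorphism) H.homomorphism
      ; F-resp-≈ = λ p → H.F-resp-≈ (G.F-resp-≈ p) }
      where
        module H = Functor H
        module G = Functor G
    mapCocone : {J : Category 0ℓ 0ℓ 0ℓ} {G : Functor J C} →
                Cocone C G → Cocone D (F ∘F G)
    mapCocone K = record
      { apex = F.F₀ (Cocone.apex K)
      ; leg  = λ j → F.F₁ (Cocone.leg K j)
      ; commute = λ u → D.Eq.trans (D.Eq.sym F.homomorphism)
                                   (F.F-resp-≈ (Cocone.commute K u)) }

IsFinitary : {S : Set} → Monad (SetS S) → Set₁
IsFinitary M = PreservesColimits IsFiltered (Monad.T M)

-- ffg-equations, solutions and ffg-Elgot algebras for an endofunctor G
-- (only the object and morphism parts of G are used)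

module ElgotDefs {o ℓ e p : Level} (C : Category o ℓ e)
       (cp : BinaryCoproducts C) (Ffg : Category.Obj C → Set p)
       (G₀ : Category.Obj C → Category.Obj C)
       (G₁ : ∀ {X Y} → Category._⇒_ C X Y → Category._⇒_ C (G₀ X) (G₀ Y)) where
  open Category C
  open BinaryCoproducts cp

  _•_ : ∀ {X A B} → A ⇒ B → X ⇒ G₀ X + A → X ⇒ G₀ X + B
  k • e = (id +₁ k) ∘ e

  can : ∀ {X Y} → G₀ X + G₀ Y ⇒ G₀ (X + Y)
  can = [ G₁ inl , G₁ inr ]

  _⊡_ : ∀ {X Y Z} → X ⇒ G₀ X + Y → Y ⇒ G₀ Y + Z → X + Y ⇒ G₀ (X + Y) + Z
  e ⊡ f = (can +₁ id) ∘ (assocʳ ∘ ((id +₁ f) ∘ [ e , inr ]))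

  IsSolution : ∀ {X A} → G₀ A ⇒ A → X ⇒ G₀ X + A → X ⇒ A → Set e
  IsSolution α e s = s ≈ [ α , id ] ∘ ((G₁ s +₁ id) ∘ e)

  Dagger : Obj → Set (o ⊔ ℓ ⊔ p)
  Dagger A = ∀ {X} → Ffg X → X ⇒ G₀ X + A → X ⇒ A

  record IsFfgElgot (A : Obj) (α : G₀ A ⇒ A) (dag : Dagger A) : Set (o ⊔ ℓ ⊔ e ⊔ p) where
    field
      dag-resp-≈ : ∀ {X} (wX : Ffg X) {e e′ : X ⇒ G₀ X + A} →
                   e ≈ e′ → dag wX e ≈ dag wX e′
      solution : ∀ {X} (wX : Ffg X) (e : X ⇒ G₀ X + A) →
                 IsSolution α e (dag wX e)
      weak-functoriality :
        ∀ {X X′ Z} (wX : Ffg X) (wX′ : Ffg X′) (wZ : Ffg Z)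
          (e : X ⇒ G₀ X + Z) (f : X′ ⇒ G₀ X′ + Z) (m : X ⇒ X′) →
          f ∘ m ≈ (G₁ m +₁ id) ∘ e → (k : Z ⇒ A) →
          dag wX′ (k • f) ∘ m ≈ dag wX (k • e)
      compositionality :
        ∀ {X Y′} (wX : Ffg X) (wY′ : Ffg Y′) (wXY′ : Ffg (X + Y′))
          (e : X ⇒ G₀ X + Y′) (f : Y′ ⇒ G₀ Y′ + A) →
          dag wX (dag wY′ f • e) ≈ dag wXY′ (e ⊡ f) ∘ inl

module Compat {o ℓ e p : Level} (C : Category o ℓ e)
       (cp : BinaryCoproducts C) (Ffg : Category.Obj C → Set p)
       (F : Functor C C) {I : Category 0ℓ 0ℓ 0ℓ} (D : Functor I C) where
  open Category C
  open BinaryCoproducts cp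
  private
    module F = Functor F
    module D = Functor D
    module I = Category I

  module ElgotY (i : I.Obj) =
    ElgotDefs C cp Ffg (λ X → F.F₀ X + D.F₀ i) (λ f → F.F₁ f +₁ id)

  record CompatibleFamily (A : Obj) (a : F.F₀ A ⇒ A)
         (h : ∀ i → D.F₀ i ⇒ A) (dag : ∀ i → ElgotY.Dagger i A)
         : Set (o ⊔ ℓ ⊔ e ⊔ p) where
    field
      elgot : ∀ i → ElgotY.IsFfgElgot i A [ a , h i ] (dag i)
      compatible : ∀ {i j} (u : i I.⇒ j) {X} (wX : Ffg X)
                   (e : X ⇒ (F.F₀ X + D.F₀ i) + A) →
                   dag j wX (((id +₁ D.F₁ u) +₁ id) ∘ e) ≈ dag i wX e

  -- e^† = ((FX + ι_i) · e)^{†,i}, with FX + (Y_i + A) identified with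
  -- (FX + Y_i) + A, so that FX + ι_i becomes inl + A
  daggerVia : ∀ {A′} (dag : ∀ i → ElgotY.Dagger i A′) → ∀ i →
              ElgotDefs.Dagger C cp Ffg F.F₀ F.F₁ A′
  daggerVia dag i wX e = dag i wX ((inl +₁ id) ∘ e)

-- Every equation e : X → FX + A for F is an equation for F(-) + Y_i via the
-- embedding ι = inl + A : FX + A → (FX + Y_i) + A, and ι commutes with all the
-- operations entering the axioms (k • -, ⊡, the solution condition).  Hence
-- restricting †ᵢ along ι yields an ffg-Elgot algebra for F, and compatibility
-- makes the restriction invariant along every u : i → k, so along cospans in
-- the filtered I.  Finally h_i is the solution of the ffg-equation
-- Y_i → (FY_i + Y_i) + A given by the coproduct injection, and compatibility
-- moves that equation along y_ij, which gives h_j · y_ij = h_i.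
module Submission where

open import Level using (Level; 0ℓ)
open import Data.Product using (_×_; _,_)
open import Relation.Binary.Bundles using (Setoid)
import Relation.Binary.Reasoning.Setoid as SetoidReasoning

open import Defs

module CategoryReasoning {o ℓ e : Level} (C : Category o ℓ e) where
  open Category C

  hom-setoid : Obj → Obj → Setoid ℓ e
  hom-setoid X Y = record { Carrier = X ⇒ Y ; _≈_ = _≈_ ; isEquivalence = equiv }

  module HomReasoning {X Y : Obj} = SetoidReasoning (hom-setoid X Y)

  infixr 4 _○_
  _○_ : ∀ {X Y} {f g h : X ⇒ Y} → f ≈ g → g ≈ h → f ≈ h
  _○_ = Eq.trans

  refl⟩∘⟨_ : ∀ {X Y Z} {f : Y ⇒ Z} {g i : X ⇒ Y} → g ≈ i → f ∘ g ≈ f ∘ i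
  refl⟩∘⟨ p = ∘-resp-≈ Eq.refl p

  _⟩∘⟨refl : ∀ {X Y Z} {f h : Y ⇒ Z} {g : X ⇒ Y} → f ≈ h → f ∘ g ≈ h ∘ g
  p ⟩∘⟨refl = ∘-resp-≈ p Eq.refl

  pullˡ : ∀ {W X Y Z} {f : Y ⇒ Z} {g : X ⇒ Y} {h : X ⇒ Z} {x : W ⇒ X} →
          f ∘ g ≈ h → f ∘ (g ∘ x) ≈ h ∘ x
  pullˡ p = Eq.sym assoc ○ p ⟩∘⟨refl

  extendʳ : ∀ {W X Y Y′ Z} {f : Y ⇒ Z} {g : X ⇒ Y} {h : Y′ ⇒ Z} {k : X ⇒ Y′}
            {x : W ⇒ X} → f ∘ g ≈ h ∘ k → f ∘ (g ∘ x) ≈ h ∘ (k ∘ x)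
  extendʳ p = pullˡ p ○ assoc

module CoproductLaws {o ℓ e : Level} (C : Category o ℓ e) (cp : BinaryCoproducts C) where
  open Category C
  open BinaryCoproducts cp
  open CategoryReasoning C public

  inject₁-∘ : ∀ {W X Y Z} {f : X ⇒ Z} {g : Y ⇒ Z} {x : W ⇒ X} →
              [ f , g ] ∘ (inl ∘ x) ≈ f ∘ x
  inject₁-∘ = pullˡ inject₁

  inject₂-∘ : ∀ {W X Y Z} {f : X ⇒ Z} {g : Y ⇒ Z} {x : W ⇒ Y} →
              [ f , g ] ∘ (inr ∘ x) ≈ g ∘ x
  inject₂-∘ = pullˡ inject₂

  [,]-cong : ∀ {X Y Z} {f f′ : X ⇒ Z} {g g′ : Y ⇒ Z} →
             f ≈ f′ → g ≈ g′ → [ f , g ] ≈ [ f′ , g′ ]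
  [,]-cong p q = unique (inject₁ ○ p) (inject₂ ○ q)

  ∘-[,] : ∀ {X Y Z W} {f : X ⇒ Z} {g : Y ⇒ Z} {h : Z ⇒ W} →
          h ∘ [ f , g ] ≈ [ h ∘ f , h ∘ g ]
  ∘-[,] = unique (assoc ○ refl⟩∘⟨ inject₁) (assoc ○ refl⟩∘⟨ inject₂)

  [,]-+₁ : ∀ {X Y X′ Y′ Z} {f : X′ ⇒ Z} {g : Y′ ⇒ Z} {h : X ⇒ X′} {k : Y ⇒ Y′} →
           [ f , g ] ∘ (h +₁ k) ≈ [ f ∘ h , g ∘ k ]
  [,]-+₁ = ∘-[,] ○ [,]-cong inject₁-∘ inject₂-∘

  +₁-cong : ∀ {X Y X′ Y′} {f f′ : X ⇒ X′} {g g′ : Y ⇒ Y′} →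
            f ≈ f′ → g ≈ g′ → f +₁ g ≈ f′ +₁ g′
  +₁-cong p q = [,]-cong (refl⟩∘⟨ p) (refl⟩∘⟨ q)

  +₁-+₁ : ∀ {X Y X′ Y′ X″ Y″} {f : X′ ⇒ X″} {g : Y′ ⇒ Y″} {h : X ⇒ X′} {k : Y ⇒ Y′} →
          (f +₁ g) ∘ (h +₁ k) ≈ (f ∘ h) +₁ (g ∘ k)
  +₁-+₁ = [,]-+₁ ○ [,]-cong assoc assoc

  +₁-id : ∀ {X Y} → id {X} +₁ id {Y} ≈ id
  +₁-id = Eq.sym (unique (identityˡ ○ Eq.sym identityʳ) (identityˡ ○ Eq.sym identityʳ))

  +₁-inl-∘ : ∀ {W X Y X′ Y′} {f : X ⇒ X′} {g : Y ⇒ Y′} {x : W ⇒ X} →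
             (f +₁ g) ∘ (inl ∘ x) ≈ inl ∘ (f ∘ x)
  +₁-inl-∘ = inject₁-∘ ○ assoc

  +₁-inr-∘ : ∀ {W X Y X′ Y′} {f : X ⇒ X′} {g : Y ⇒ Y′} {x : W ⇒ Y} →
             (f +₁ g) ∘ (inr ∘ x) ≈ inr ∘ (g ∘ x)
  +₁-inr-∘ = inject₂-∘ ○ assoc

  assocʳ-natural : ∀ {X Y Z X′ Y′ Z′} {f : X ⇒ X′} {g : Y ⇒ Y′} {h : Z ⇒ Z′} →
                   assocʳ ∘ (f +₁ (g +₁ h)) ≈ ((f +₁ g) +₁ h) ∘ assocʳ
  assocʳ-natural {X} {Y} {Z} {X′} {Y′} {Z′} {f} {g} {h} = begin
    assocʳ ∘ (f +₁ (g +₁ h))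
      ≈⟨ [,]-+₁ ○ [,]-cong Eq.refl [,]-+₁ ⟩
    [ (inl ∘ inl) ∘ f , [ (inl ∘ inr) ∘ g , inr ∘ h ] ]
      ≈⟨ [,]-cong (inl-case inject₁) ([,]-cong (inl-case inject₂) inject₂) ⟨
    [ ((f +₁ g) +₁ h) ∘ (inl ∘ inl) , [ ((f +₁ g) +₁ h) ∘ (inl ∘ inr) , ((f +₁ g) +₁ h) ∘ inr ] ]
      ≈⟨ ∘-[,] ○ [,]-cong Eq.refl ∘-[,] ⟨
    ((f +₁ g) +₁ h) ∘ assocʳ
      ∎
    where
    open HomReasoning
    inl-case : ∀ {W W′} {x : W ⇒ X + Y} {x′ : W′ ⇒ X′ + Y′} {y : W ⇒ W′} →
               (f +₁ g) ∘ x ≈ x′ ∘ y → ((f +₁ g) +₁ h) ∘ (inl ∘ x) ≈ (inl ∘ x′) ∘ y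
    inl-case p = +₁-inl-∘ ○ refl⟩∘⟨ p ○ Eq.sym assoc

  inl+₁id-natural : ∀ {X X′ Y Y′ Z Z′} {f : X ⇒ X′} {f′ : X + Y ⇒ X′ + Y′} {k : Z ⇒ Z′} →
                    f′ ∘ inl ≈ inl ∘ f → (f′ +₁ k) ∘ (inl +₁ id) ≈ (inl +₁ id) ∘ (f +₁ k)
  inl+₁id-natural p = +₁-+₁ ○ +₁-cong p (identityʳ ○ Eq.sym identityˡ) ○ Eq.sym +₁-+₁

  [+₁,+₁]-inl+₁inl : ∀ {X X′ Y Z} {g : X ⇒ Z} {g′ : X′ ⇒ Z} →
                     [ g +₁ id {Y} , g′ +₁ id ] ∘ (inl +₁ inl) ≈ inl ∘ [ g , g′ ]
  [+₁,+₁]-inl+₁inl = [,]-+₁ ○ [,]-cong inject₁ inject₁ ○ Eq.sym ∘-[,]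

module ParameterRestriction {o ℓ e p : Level} (C : Category o ℓ e) (cp : BinaryCoproducts C)
       (Ffg : Category.Obj C → Set p) (F : Functor C C) (Y : Category.Obj C) where
  open Category C
  open BinaryCoproducts cp
  open CoproductLaws C cp
  open HomReasoning
  private
    module F = Functor F
  module E = ElgotDefs C cp Ffg F.F₀ F.F₁
  module EY = ElgotDefs C cp Ffg (λ X → F.F₀ X + Y) (λ f → F.F₁ f +₁ id)

  ι : ∀ {P Z} → P + Z ⇒ (P + Y) + Z
  ι = inl +₁ id

  •-restrict : ∀ {X Z A} (k : Z ⇒ A) (e : X ⇒ F.F₀ X + Z) → k EY.• (ι ∘ e) ≈ ι ∘ (k E.• e)
  •-restrict k e = extendʳ (inl+₁id-natural (identityˡ ○ Eq.sym identityʳ))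

  equation-restrict : ∀ {X X′ Z} {e : X ⇒ F.F₀ X + Z} {f : X′ ⇒ F.F₀ X′ + Z} {m : X ⇒ X′} →
                      f ∘ m ≈ (F.F₁ m +₁ id) ∘ e →
                      (ι ∘ f) ∘ m ≈ ((F.F₁ m +₁ id) +₁ id) ∘ (ι ∘ e)
  equation-restrict p = assoc ○ refl⟩∘⟨ p ○ Eq.sym (extendʳ (inl+₁id-natural inject₁))

  solution-restrict : ∀ {X A} {a : F.F₀ A ⇒ A} {h : Y ⇒ A} {e : X ⇒ F.F₀ X + A} {s : X ⇒ A} →
                      EY.IsSolution [ a , h ] (ι ∘ e) s → E.IsSolution a e s
  solution-restrict {a = a} {h} {e} {s} sol = begin
    s                                                          ≈⟨ sol ⟩
    [ [ a , h ] , id ] ∘ (((F.F₁ s +₁ id) +₁ id) ∘ (ι ∘ e))    ≈⟨ refl⟩∘⟨ extendʳ (inl+₁id-natural inject₁) ⟩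
    [ [ a , h ] , id ] ∘ (ι ∘ ((F.F₁ s +₁ id) ∘ e))            ≈⟨ pullˡ ([,]-+₁ ○ [,]-cong inject₁ identityʳ) ⟩
    [ a , id ] ∘ ((F.F₁ s +₁ id) ∘ e)                          ∎

  parameter-solution : ∀ {W A} {a : F.F₀ A ⇒ A} {h : Y ⇒ A} {x : W ⇒ Y} {s : W ⇒ A} →
                       EY.IsSolution [ a , h ] (inl ∘ (inr ∘ x)) s → s ≈ h ∘ x
  parameter-solution {a = a} {h} {x} {s} sol = begin
    s                                                                ≈⟨ sol ⟩
    [ [ a , h ] , id ] ∘ (((F.F₁ s +₁ id) +₁ id) ∘ (inl ∘ (inr ∘ x))) ≈⟨ refl⟩∘⟨ +₁-inl-∘ ⟩
    [ [ a , h ] , id ] ∘ (inl ∘ ((F.F₁ s +₁ id) ∘ (inr ∘ x)))         ≈⟨ inject₁-∘ ⟩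
    [ a , h ] ∘ ((F.F₁ s +₁ id) ∘ (inr ∘ x))                         ≈⟨ refl⟩∘⟨ +₁-inr-∘ ⟩
    [ a , h ] ∘ (inr ∘ (id ∘ x))                                     ≈⟨ inject₂-∘ ○ refl⟩∘⟨ identityˡ ⟩
    h ∘ x                                                            ∎

  ⊡-restrict : ∀ {X Y′ A} (e : X ⇒ F.F₀ X + Y′) (f : Y′ ⇒ F.F₀ Y′ + A) →
               (ι ∘ e) EY.⊡ (ι ∘ f) ≈ ι ∘ (e E.⊡ f)
  ⊡-restrict e f = begin
    (EY.can +₁ id) ∘ (assocʳ ∘ ((id +₁ ι ∘ f) ∘ [ ι ∘ e , inr ]))
      ≈⟨ refl⟩∘⟨ refl⟩∘⟨ refl⟩∘⟨ ([,]-cong Eq.refl (Eq.sym (inject₂ ○ identityʳ)) ○ Eq.sym ∘-[,]) ⟩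
    (EY.can +₁ id) ∘ (assocʳ ∘ ((id +₁ ι ∘ f) ∘ (ι ∘ [ e , inr ])))
      ≈⟨ refl⟩∘⟨ refl⟩∘⟨ extendʳ (+₁-+₁ ○ +₁-cong (identityˡ ○ Eq.sym identityʳ) identityʳ ○ Eq.sym +₁-+₁) ⟩
    (EY.can +₁ id) ∘ (assocʳ ∘ ((inl +₁ ι) ∘ ((id +₁ f) ∘ [ e , inr ])))
      ≈⟨ refl⟩∘⟨ extendʳ assocʳ-natural ⟩
    (EY.can +₁ id) ∘ (((inl +₁ inl) +₁ id) ∘ (assocʳ ∘ ((id +₁ f) ∘ [ e , inr ])))
      ≈⟨ extendʳ (+₁-+₁ ○ +₁-cong [+₁,+₁]-inl+₁inl Eq.refl ○ Eq.sym +₁-+₁) ⟩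
    ι ∘ ((E.can +₁ id) ∘ (assocʳ ∘ ((id +₁ f) ∘ [ e , inr ])))
      ∎

  restrict-IsFfgElgot : ∀ {A} {a : F.F₀ A ⇒ A} {h : Y ⇒ A} {dag : EY.Dagger A} →
                        EY.IsFfgElgot A [ a , h ] dag →
                        E.IsFfgElgot A a (λ wX e → dag wX (ι ∘ e))
  restrict-IsFfgElgot {dag = dag} elgot = record
    { dag-resp-≈ = λ wX p → Y.dag-resp-≈ wX (refl⟩∘⟨ p)
    ; solution = λ wX e → solution-restrict (Y.solution wX (ι ∘ e))
    ; weak-functoriality = λ wX wX′ wZ e f m p k → begin
        dag wX′ (ι ∘ (k E.• f)) ∘ m    ≈⟨ Y.dag-resp-≈ wX′ (•-restrict k f) ⟩∘⟨refl ⟨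
        dag wX′ (k EY.• (ι ∘ f)) ∘ m   ≈⟨ Y.weak-functoriality wX wX′ wZ (ι ∘ e) (ι ∘ f) m (equation-restrict p) k ⟩
        dag wX (k EY.• (ι ∘ e))        ≈⟨ Y.dag-resp-≈ wX (•-restrict k e) ⟩
        dag wX (ι ∘ (k E.• e))         ∎
    ; compositionality = λ wX wY′ wXY′ e f → begin
        dag wX (ι ∘ (dag wY′ (ι ∘ f) E.• e))    ≈⟨ Y.dag-resp-≈ wX (•-restrict (dag wY′ (ι ∘ f)) e) ⟨
        dag wX (dag wY′ (ι ∘ f) EY.• (ι ∘ e))   ≈⟨ Y.compositionality wX wY′ wXY′ (ι ∘ e) (ι ∘ f) ⟩
        dag wXY′ ((ι ∘ e) EY.⊡ (ι ∘ f)) ∘ inl   ≈⟨ Y.dag-resp-≈ wXY′ (⊡-restrict e f) ⟩∘⟨refl ⟩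
        dag wXY′ (ι ∘ (e E.⊡ f)) ∘ inl          ∎
    }
    where module Y = EY.IsFfgElgot elgot

module CompatibleFamilyProperties {o ℓ e p : Level} (C : Category o ℓ e) (cp : BinaryCoproducts C)
       (Ffg : Category.Obj C → Set p) (F : Functor C C) {I : Category 0ℓ 0ℓ 0ℓ} (D : Functor I C)
       {A : Category.Obj C} {a : Category._⇒_ C (Functor.F₀ F A) A}
       {h : ∀ i → Category._⇒_ C (Functor.F₀ D i) A} {dag : ∀ i → Compat.ElgotY.Dagger C cp Ffg F D i A}
       (family : Compat.CompatibleFamily C cp Ffg F D A a h dag) where
  open Category C
  open BinaryCoproducts cp
  open CoproductLaws C cp
  open HomReasoning
  open Compat C cp Ffg F D
  open CompatibleFamily family
  private
    module F = Functor F
    module D = Functor D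
    module I = Category I
    module Elgot i = ElgotY.IsFfgElgot i (elgot i)
    module Restriction i = ParameterRestriction C cp Ffg F (D.F₀ i)

  daggerVia-IsFfgElgot : ∀ i → ElgotDefs.IsFfgElgot C cp Ffg F.F₀ F.F₁ A a (daggerVia dag i)
  daggerVia-IsFfgElgot i = Restriction.restrict-IsFfgElgot i (elgot i)

  daggerVia-transport : ∀ {i k} (u : i I.⇒ k) {X} (wX : Ffg X) (e : X ⇒ F.F₀ X + A) →
                        daggerVia dag i wX e ≈ daggerVia dag k wX e
  daggerVia-transport {i} {k} u wX e = begin
    dag i wX ((inl +₁ id) ∘ e)                             ≈⟨ compatible u wX ((inl +₁ id) ∘ e) ⟨
    dag k wX (((id +₁ D.F₁ u) +₁ id) ∘ ((inl +₁ id) ∘ e))  ≈⟨ Elgot.dag-resp-≈ k wX (pullˡ absorb) ⟩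
    dag k wX ((inl +₁ id) ∘ e)                             ∎
    where
    absorb : ((id +₁ D.F₁ u) +₁ id) ∘ (inl +₁ id) ≈ inl +₁ id
    absorb = inl+₁id-natural inject₁ ○ refl⟩∘⟨ +₁-id ○ identityʳ

  daggerVia-independent : IsFiltered I → ∀ i j {X} (wX : Ffg X) (e : X ⇒ F.F₀ X + A) →
                          daggerVia dag i wX e ≈ daggerVia dag j wX e
  daggerVia-independent filtered i j wX e with IsFiltered.cospan filtered i j
  ... | k , u , v = daggerVia-transport u wX e ○ Eq.sym (daggerVia-transport v wX e)

  h-cocone : (∀ i → Ffg (D.F₀ i)) → ∀ {i j} (u : i I.⇒ j) → h j ∘ D.F₁ u ≈ h i
  h-cocone ffg {i} {j} u = begin
    h j ∘ D.F₁ u                                              ≈⟨ dag-parameter j (D.F₁ u) ⟨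
    dag j (ffg i) (inl ∘ (inr ∘ D.F₁ u))                      ≈⟨ Elgot.dag-resp-≈ j (ffg i) transported ⟩
    dag j (ffg i) (((id +₁ D.F₁ u) +₁ id) ∘ (inl ∘ (inr ∘ id))) ≈⟨ compatible u (ffg i) (inl ∘ (inr ∘ id)) ⟩
    dag i (ffg i) (inl ∘ (inr ∘ id))                          ≈⟨ dag-parameter i id ○ identityʳ ⟩
    h i                                                       ∎
    where
    dag-parameter : ∀ k (x : D.F₀ i ⇒ D.F₀ k) → dag k (ffg i) (inl ∘ (inr ∘ x)) ≈ h k ∘ x
    dag-parameter k x = Restriction.parameter-solution k (Elgot.solution k (ffg i) (inl ∘ (inr ∘ x)))
    transported : inl ∘ (inr ∘ D.F₁ u) ≈ ((id +₁ D.F₁ u) +₁ id {A}) ∘ (inl ∘ (inr ∘ id))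
    transported = Eq.sym (+₁-inl-∘ ○ refl⟩∘⟨ (+₁-inr-∘ ○ refl⟩∘⟨ identityʳ))

mainTheorem14 :
    (S : Set) (M : Monad (SetS S)) → IsFinitary M →
    (cp : BinaryCoproducts (EM M)) →
    (F : Functor (EM M) (EM M)) → PreservesColimits IsSifted F →
    (I : Category 0ℓ 0ℓ 0ℓ) → IsFiltered I →
    (D : Functor I (EM M)) → (∀ i → IsFfg M (Functor.F₀ D i)) →
    (K : Cocone (EM M) D) → IsColimit (EM M) D K →
    (A : Category.Obj (EM M)) →
    (a : Category._⇒_ (EM M) (Functor.F₀ F A) A) →
    (h : ∀ i → Category._⇒_ (EM M) (Functor.F₀ D i) A) →
    (dag : ∀ i → Compat.ElgotY.Dagger (EM M) cp (IsFfg M) F D i A) →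
    Compat.CompatibleFamily (EM M) cp (IsFfg M) F D A a h dag →
    let open Category (EM M)
        open Compat (EM M) cp (IsFfg M) F D
    in
    -- (i) e^† does not depend on the choice of i
    (∀ i j {X} (wX : IsFfg M X)
       (e : X ⇒ BinaryCoproducts._+_ cp (Functor.F₀ F X) A) →
       daggerVia dag i wX e ≈ daggerVia dag j wX e)
    -- (ii) (A , a , †) is an ffg-Elgot algebra for F
    × (∀ i → ElgotDefs.IsFfgElgot (EM M) cp (IsFfg M)
               (Functor.F₀ F) (Functor.F₁ F) A a (daggerVia dag i))
    -- (iii) the h_i form a cocone of D_Y
    × (∀ {i j} (u : Category._⇒_ I i j) → h j ∘ Functor.F₁ D u ≈ h i)
mainTheorem14 _ M _ cp F _ I filtered D ffg _ _ A a h dag family =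
  daggerVia-independent filtered , daggerVia-IsFfgElgot , h-cocone ffg
  where open CompatibleFamilyProperties (EM M) cp (IsFfg M) F D family
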